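{- For any positive integers $d,r,s$, we have $N_{d,r}(s)<\infty$ if and only if $\gcd(s,r)\le d$.
   Context: A partition $\lambda=(\lambda_1,\dots,\lambda_k)$ is a finite nonincreasing sequence of positive integers (the empty partition is allowed). In its Young diagram (row $i$ has $\lambda_i$ left-justified cells), the hook length $h(i,j)$ of cell $(i,j)$ is $1$ plus the number of cells to its right in its row plus the number of cells below it in its column. For a positive integer $t$, $\lambda$ is $t$-core if no cell has hook length $t$; it is $(s,s+r)$-core if it is both $s$-core and $(s+r)$-core. $\lambda$ has $d$-distinct parts if $\lambda_i-\lambda_{i+1}\ge d$ for all $1\le i\le k-1$. $N_{d,r}(s)\in\mathbb{Z}_{\ge0}\cup\{\infty\}$ is the number of $(s,s+r)$-core partitions with $d$-distinct parts. -}

module Defs where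

open import Data.Nat using (ℕ; zero; suc; _+_; _∸_; _≤_; _<_; _≥_; _<?_)
open import Data.Nat.GCD using (gcd)
open import Data.List using (List; []; _∷_; length; lookup; drop; filter)
open import Data.List.Relation.Unary.All using (All)
open import Data.List.Relation.Unary.Linked using (Linked)
open import Data.List.Membership.Propositional using (_∈_)
open import Data.Fin using (Fin; toℕ)
open import Data.Product using (∃-syntax; _×_)
open import Relation.Binary.PropositionalEquality using (_≡_; _≢_)

IsPartition : List ℕ → Set
IsPartition λ′ = All (λ x → 1 ≤ x) λ′ × Linked _≥_ λ′

-- Hook length of cell (i , j) (0-indexed; row i, column j, with j < λ_i):
-- 1 + (cells to the right in row i) + (cells below in column j).
armLength : (λ′ : List ℕ) → Fin (length λ′) → ℕ → ℕ
armLength λ′ i j = lookup λ′ i ∸ suc j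

legLength : (λ′ : List ℕ) → Fin (length λ′) → ℕ → ℕ
legLength λ′ i j = length (filter (λ p → j <? p) (drop (suc (toℕ i)) λ′))

hookLength : (λ′ : List ℕ) → Fin (length λ′) → ℕ → ℕ
hookLength λ′ i j = 1 + armLength λ′ i j + legLength λ′ i j

IsCore : ℕ → List ℕ → Set
IsCore t λ′ = (i : Fin (length λ′)) (j : ℕ) → j < lookup λ′ i → hookLength λ′ i j ≢ t

IsBiCore : ℕ → ℕ → List ℕ → Set
IsBiCore s r λ′ = IsCore s λ′ × IsCore (s + r) λ′

DDistinct : ℕ → List ℕ → Set
DDistinct d λ′ = Linked (λ x y → y + d ≤ x) λ′

Counted : ℕ → ℕ → ℕ → List ℕ → Set
Counted d r s λ′ = IsPartition λ′ × IsBiCore s r λ′ × DDistinct d λ′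

NFinite : ℕ → ℕ → ℕ → Set
NFinite d r s = ∃[ L ] ((λ′ : List ℕ) → Counted d r s λ′ → λ′ ∈ L)

-- Record a partition λ = (λ₀ ≥ … ≥ λₖ₋₁) by its β-numbers βᵢ = λᵢ + (k − 1 − i), the hook lengths of
-- its first column. The hook lengths of row 0 are exactly the differences β₀ − w with w < β₀ not a
-- β-number, so λ is a t-core iff its β-set is closed under w + t ↦ w. When the parts are d-distinct,
-- consecutive β-numbers differ by more than d. If g = gcd(s, r) ≤ d, Bézout gives m₁ t₁ = g + m₂ t₂
-- with {t₁, t₂} = {s, s + r}; a β-number b ≥ m₁ t₁ would then yield β-numbers w and w + g, so all
-- β-numbers of the counted partitions are below m₁ t₁ and there are finitely many. If g > d, the
-- staircases (k c, …, 2c, c) with c = g − 1 ≥ d have β-set {i g + c : i < k}, hence are cores for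
-- every multiple of g, and they have arbitrarily many parts.
module Submission where

open import Defs
open import Data.Empty using (⊥-elim)
import Data.Fin as Fin
open import Data.List
  using (List; []; _∷_; [_]; length; filter; map; upTo; applyDownFrom; cartesianProductWith)
open import Data.List.Properties using (filter-accept; filter-none)
open import Data.List.Membership.Propositional using (_∈_; _∉_)
open import Data.List.Membership.Propositional.Properties
  using (∈-upTo⁺; ∈-map⁺; ∈-cartesianProductWith⁺; ∈-applyDownFrom⁺; ∈-applyDownFrom⁻)
open import Data.List.Relation.Unary.All as All using (All; []; _∷_)
open import Data.List.Relation.Unary.Any using (here; there)
open import Data.List.Relation.Unary.Linked as Linked using (Linked; []; [-]; _∷_)
open import Data.List.Relation.Unary.Linked.Properties using (Linked⇒All)
open import Data.Nat
open import Data.Nat.Divisibility using (_∣_; divides; ∣m∣n⇒∣m+n)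
open import Data.Nat.GCD using (gcd; gcd-GCD; module GCD; module Bézout; gcd[m,n]≢0; gcd[m,n]∣m; gcd[m,n]∣n)
open import Data.Nat.ListAction using (sum)
open import Data.Nat.Properties
open import Data.Nat.Tactic.RingSolver using (solve-∀)
open import Data.Product using (_×_; _,_; proj₁; proj₂; ∃; ∃₂)
open import Data.Sum using (_⊎_; inj₁; inj₂)
open import Function.Bundles using (_⇔_; mk⇔; Equivalence)
open import Relation.Binary.Definitions using (tri<; tri≈; tri>)
open import Relation.Binary.PropositionalEquality
  using (_≡_; refl; sym; trans; cong; cong₂; subst; module ≡-Reasoning)
open import Relation.Nullary using (¬_; yes; no)
open import Relation.Nullary.Decidable using (decidable-stable)

∈⇒≤sum : ∀ {n ns} → n ∈ ns → n ≤ sum ns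
∈⇒≤sum (here refl) = m≤m+n _ _
∈⇒≤sum {ns = m ∷ _} (there n∈ns) = ≤-trans (∈⇒≤sum n∈ns) (m≤n+m _ m)

head≥all : ∀ {x ys} → Linked _≥_ (x ∷ ys) → All (_≤ x) (x ∷ ys)
head≥all = Linked⇒All (λ j≤i k≤j → ≤-trans k≤j j≤i) ≤-refl

distinct⇒nonincreasing : ∀ {d λ′} → DDistinct d λ′ → Linked _≥_ λ′
distinct⇒nonincreasing {d} = Linked.map (λ {_} {y} y+d≤x → ≤-trans (m≤m+n y d) y+d≤x)

nonincreasing⇒0-distinct : ∀ {λ′} → Linked _≥_ λ′ → DDistinct 0 λ′
nonincreasing⇒0-distinct = Linked.map (λ {x} {y} y≤x → subst (_≤ x) (sym (+-identityʳ y)) y≤x)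

SubtractionClosed : ℕ → List ℕ → Set
SubtractionClosed t B = ∀ {w} → t + w ∈ B → w ∈ B

subtractionClosed-* : ∀ {t B} → SubtractionClosed t B → ∀ m {w} → m * t + w ∈ B → w ∈ B
subtractionClosed-* closed zero w∈B = w∈B
subtractionClosed-* {t} {B} closed (suc m) {w} p =
  subtractionClosed-* closed m (closed (subst (_∈ B) (+-assoc t (m * t) w) p))

Spaced : ℕ → List ℕ → Set
Spaced d = Linked (λ a b → b + d < a)

spaced-∈ : ∀ {d b bs v} → Spaced d (b ∷ bs) → v ∈ bs → v + d < b
spaced-∈ {d} (c+d<b ∷ spaced) = All.lookup (Linked⇒All gap-trans c+d<b spaced)
  where
  gap-trans : ∀ {a b c} → b + d < a → c + d < b → c + d < a
  gap-trans {b = b} b+d<a c+d<b = <-trans c+d<b (≤-<-trans (m≤m+n b d) b+d<a)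

spaced-gap : ∀ {d g bs u} → Spaced d bs → 1 ≤ g → g ≤ d → u ∈ bs → u + g ∉ bs
spaced-gap {u = u} _ 1≤g _ (here refl) (here u+g≡u) = <-irrefl (sym u+g≡u) (m<m+n u 1≤g)
spaced-gap {d} {g} {u = u} spaced _ _ (here refl) (there u+g∈) =
  <⇒≱ (spaced-∈ spaced u+g∈) (≤-trans (m≤m+n u g) (m≤m+n (u + g) d))
spaced-gap {u = u} spaced _ g≤d (there u∈) (here refl) = <⇒≱ (spaced-∈ spaced u∈) (+-monoʳ-≤ u g≤d)
spaced-gap spaced 1≤g g≤d (there u∈) (there u+g∈) = spaced-gap (Linked.tail spaced) 1≤g g≤d u∈ u+g∈

spaced-closed-bounded : ∀ {d g t₁ t₂ B} → Spaced d B →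
                        SubtractionClosed t₁ B → SubtractionClosed t₂ B → 1 ≤ g → g ≤ d →
                        ∀ m₁ m₂ → g + m₂ * t₂ ≡ m₁ * t₁ → ∀ {b} → b ∈ B → b < m₁ * t₁
spaced-closed-bounded {d} {g} {t₁} {t₂} {B} spaced closed₁ closed₂ 1≤g g≤d m₁ m₂ bézout {b} b∈B
  with m₁ * t₁ ≤? b
... | no b≱ = ≰⇒> b≱
... | yes m₁t₁≤b with w , refl ← m≤n⇒∃[o]m+o≡n m₁t₁≤b =
  ⊥-elim (spaced-gap spaced 1≤g g≤d (subtractionClosed-* closed₁ m₁ b∈B)
                                    (subtractionClosed-* closed₂ m₂ (subst (_∈ B) shift b∈B)))
  where
  shift : m₁ * t₁ + w ≡ m₂ * t₂ + (w + g)
  shift = let open ≡-Reasoning in begin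
    m₁ * t₁ + w        ≡⟨ cong (_+ w) bézout ⟨
    g + m₂ * t₂ + w    ≡⟨ rearrange g (m₂ * t₂) w ⟩
    m₂ * t₂ + (w + g)  ∎
    where
    rearrange : ∀ g a w → g + a + w ≡ a + (w + g)
    rearrange = solve-∀

betas : List ℕ → List ℕ
betas [] = []
betas (y ∷ ys) = y + length ys ∷ betas ys

betas-spaced : ∀ {d λ′} → DDistinct d λ′ → Spaced d (betas λ′)
betas-spaced [] = []
betas-spaced [-] = [-]
betas-spaced {d} {x ∷ y ∷ ys} (y+d≤x ∷ distinct) = step ∷ betas-spaced distinct
  where
  m = length ys
  swap : ∀ y m d → y + m + d ≡ y + d + m
  swap = solve-∀
  step : y + m + d < x + suc m
  step = ≤-<-trans (≤-reflexive (swap y m d)) (+-mono-≤-< y+d≤x (n<1+n m))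

betas-tail-< : ∀ {x ys b} → Linked _≥_ (x ∷ ys) → b ∈ betas ys → b < x + length ys
betas-tail-< {b = b} mono b∈ =
  ≤-<-trans (m≤m+n b 0) (spaced-∈ (betas-spaced (nonincreasing⇒0-distinct mono)) b∈)

BetaClosed : ℕ → List ℕ → Set
BetaClosed t λ′ = SubtractionClosed t (betas λ′)

betaClosed-tail : ∀ {t x ys} → Linked _≥_ (x ∷ ys) → BetaClosed t (x ∷ ys) → BetaClosed t ys
betaClosed-tail {t} mono closed t+w∈ with closed (there t+w∈)
... | there w∈ = w∈
... | here refl = ⊥-elim (<⇒≱ (betas-tail-< mono t+w∈) (m≤n+m _ t))

countAbove : ℕ → List ℕ → ℕ
countAbove j ys = length (filter (j <?_) ys)

countAbove-≤ : ∀ {j ys} → All (_≤ j) ys → countAbove j ys ≡ 0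
countAbove-≤ {j} ys≤j = cong length (filter-none (j <?_) (All.map (λ y≤j j<y → <⇒≱ j<y y≤j) ys≤j))

countAbove-< : ∀ {j y} ys → j < y → countAbove j (y ∷ ys) ≡ suc (countAbove j ys)
countAbove-< {j} ys j<y = cong length (filter-accept (j <?_) j<y)

-- t is the hook length of the cell (0, j) of x ∷ ys, whose arm is a.
FirstRowHook : ℕ → List ℕ → ℕ → Set
FirstRowHook x ys t = ∃₂ λ j a → x ≡ suc (j + a) × suc (a + countAbove j ys) ≡ t

hookLength-firstRow : ∀ {ys} j a → hookLength (suc (j + a) ∷ ys) Fin.zero j ≡ suc (a + countAbove j ys)
hookLength-firstRow {ys} j a = cong (λ arm → suc (arm + countAbove j ys)) (m+n∸m≡n j a)

firstRowHook-overhang : ∀ {y ys t q} → Linked _≥_ (y ∷ ys) → FirstRowHook (y + (suc t + q)) (y ∷ ys) (suc t)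
firstRowHook-overhang {y} {ys} {t} {q} mono = y + q , t , reorder y t q , cong suc hook
  where
  reorder : ∀ y t q → y + (suc t + q) ≡ suc (y + q + t)
  reorder = solve-∀
  hook : t + countAbove (y + q) (y ∷ ys) ≡ t
  hook = trans (cong (t +_) (countAbove-≤ (All.map (λ z≤y → ≤-trans z≤y (m≤m+n y q)) (head≥all mono))))
               (+-identityʳ t)

firstRowHook-above : ∀ {y ys t e} → FirstRowHook y ys t → FirstRowHook (y + e) (y ∷ ys) (suc e + t)
firstRowHook-above {ys = ys} {t} {e} (j , a , refl , hook) = j , a + e , cong suc (+-assoc j a e) , shifted
  where
  c = countAbove j ys
  reorder : ∀ a e c → suc (a + e + suc c) ≡ suc e + suc (a + c)
  reorder = solve-∀
  shifted : suc (a + e + countAbove j (suc (j + a) ∷ ys)) ≡ suc e + t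
  shifted = let open ≡-Reasoning in begin
    suc (a + e + countAbove j (suc (j + a) ∷ ys))
      ≡⟨ cong (λ n → suc (a + e + n)) (countAbove-< ys (s≤s (m≤m+n j a))) ⟩
    suc (a + e + suc c)                            ≡⟨ reorder a e c ⟩
    suc e + suc (a + c)                            ≡⟨ cong (suc e +_) hook ⟩
    suc e + t                                      ∎

firstRowHook⊎beta : ∀ {x ys t w} → Linked _≥_ (x ∷ ys) → suc t + w ≡ x + length ys →
                    FirstRowHook x ys (suc t) ⊎ w ∈ betas ys
firstRowHook⊎beta {x} {[]} {t} {w} _ eq =
  inj₁ (w , t , trans (sym (+-identityʳ x)) (trans (sym eq) (cong suc (+-comm t w))) ,
        cong suc (+-identityʳ t))
firstRowHook⊎beta {ys = y ∷ ys} {t} {w} (y≤x ∷ mono) eq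
  with e , refl ← m≤n⇒∃[o]m+o≡n y≤x
  with <-cmp t e
... | tri< t<e _ _ with q , refl ← m≤n⇒∃[o]m+o≡n t<e = inj₁ (firstRowHook-overhang mono)
... | tri≈ _ refl _ = inj₂ (here (+-cancelˡ-≡ (suc e) w (y + length ys) (trans eq (shift y e (length ys)))))
  where
  shift : ∀ y e m → y + e + suc m ≡ suc e + (y + m)
  shift = solve-∀
... | tri> _ _ e<t with o , refl ← m≤n⇒∃[o]m+o≡n e<t
  with firstRowHook⊎beta mono
         (+-cancelˡ-≡ (suc e) (suc o + w) (y + length ys) (peel y e o w (length ys) eq))
  where
  peel : ∀ y e o w m → suc (suc e + o) + w ≡ y + e + suc m → suc e + (suc o + w) ≡ suc e + (y + m)
  peel y e o w m eq = trans (regroup e o w) (trans eq (shift y e m))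
    where
    regroup : ∀ e o w → suc e + (suc o + w) ≡ suc (suc e + o) + w
    regroup = solve-∀
    shift : ∀ y e m → y + e + suc m ≡ suc e + (y + m)
    shift = solve-∀
... | inj₂ w∈ = inj₂ (there w∈)
... | inj₁ hook = inj₁ (subst (FirstRowHook (y + e) (y ∷ ys)) (+-suc (suc e) o) (firstRowHook-above hook))

firstRowHook-gap : ∀ {ys} j a → Linked _≥_ (suc (j + a) ∷ ys) →
                   ∃ λ w → suc (a + countAbove j ys) + w ≡ suc (j + a) + length ys × w ∉ betas ys
firstRowHook-gap {[]} j a _ = j , balance j a , λ ()
  where
  balance : ∀ j a → suc (a + 0) + j ≡ suc (j + a) + 0
  balance = solve-∀
firstRowHook-gap {y ∷ ys} j a (y≤x ∷ mono) with y ≤? j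
... | yes y≤j = j + suc m , balanced , beyond
  where
  m = length ys
  balance : ∀ j a m → suc (a + 0) + (j + suc m) ≡ suc (j + a) + suc m
  balance = solve-∀
  balanced : suc (a + countAbove j (y ∷ ys)) + (j + suc m) ≡ suc (j + a) + suc m
  balanced = trans (cong (λ c → suc (a + c) + (j + suc m))
                         (countAbove-≤ (All.map (λ z≤y → ≤-trans z≤y y≤j) (head≥all mono))))
                   (balance j a m)
  y+m<w : y + m < j + suc m
  y+m<w = +-mono-≤-< y≤j (n<1+n m)
  beyond : j + suc m ∉ betas (y ∷ ys)
  beyond (here w≡) = <-irrefl (sym w≡) y+m<w
  beyond (there w∈) = <-asym (betas-tail-< mono w∈) y+m<w
... | no y≰j with a₀ , refl ← m≤n⇒∃[o]m+o≡n (≰⇒> y≰j)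
  with w , balanced , w∉ ← firstRowHook-gap j a₀ mono = w , goal , beyond
  where
  m = length ys
  c = countAbove j ys
  c+w≡j+m : c + w ≡ j + m
  c+w≡j+m = +-cancelˡ-≡ (suc a₀) (c + w) (j + m) (trans (regroup a₀ c w) (trans balanced (swap j a₀ m)))
    where
    regroup : ∀ a c w → suc a + (c + w) ≡ suc (a + c) + w
    regroup = solve-∀
    swap : ∀ j a m → suc (j + a) + m ≡ suc a + (j + m)
    swap = solve-∀
  reorder : ∀ a c w → suc (a + suc c) + w ≡ suc (suc (a + (c + w)))
  reorder = solve-∀
  reorder′ : ∀ j a m → suc (suc (a + (j + m))) ≡ suc (j + a) + suc m
  reorder′ = solve-∀
  goal : suc (a + countAbove j (suc (j + a₀) ∷ ys)) + w ≡ suc (j + a) + suc m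
  goal = let open ≡-Reasoning in begin
    suc (a + countAbove j (suc (j + a₀) ∷ ys)) + w
      ≡⟨ cong (λ n → suc (a + n) + w) (countAbove-< ys (s≤s (m≤m+n j a₀))) ⟩
    suc (a + suc c) + w                             ≡⟨ reorder a c w ⟩
    suc (suc (a + (c + w)))                         ≡⟨ cong (λ n → suc (suc (a + n))) c+w≡j+m ⟩
    suc (suc (a + (j + m)))                         ≡⟨ reorder′ j a m ⟩
    suc (j + a) + suc m                             ∎
  beyond : w ∉ betas (suc (j + a₀) ∷ ys)
  beyond (here w≡) = <-irrefl w≡ (subst (w <_) balanced (s≤s (m≤n+m w (a₀ + c))))
  beyond (there w∈) = w∉ w∈

core⇒betaClosed : ∀ {t} λ′ → Linked _≥_ λ′ → IsCore t λ′ → BetaClosed t λ′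
core⇒betaClosed {zero} _ _ _ w∈ = w∈
core⇒betaClosed {suc t} (x ∷ ys) mono core (here eq) with firstRowHook⊎beta mono eq
... | inj₂ w∈ = there w∈
... | inj₁ (j , a , refl , hook) =
  ⊥-elim (core Fin.zero j (s≤s (m≤m+n j a)) (trans (hookLength-firstRow {ys} j a) hook))
core⇒betaClosed {suc t} (x ∷ ys) mono core (there t+w∈) =
  there (core⇒betaClosed ys (Linked.tail mono) (λ i → core (Fin.suc i)) t+w∈)

betaClosed⇒core : ∀ {t} λ′ → Linked _≥_ λ′ → BetaClosed t λ′ → IsCore t λ′
betaClosed⇒core (x ∷ ys) mono closed Fin.zero j j<x hook≡t
  with a , refl ← m≤n⇒∃[o]m+o≡n j<x
  with w , balanced , w∉ ← firstRowHook-gap j a mono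
  with closed (here (trans (cong (_+ w) (trans (sym hook≡t) (hookLength-firstRow {ys} j a))) balanced))
... | here w≡ = <-irrefl w≡ (subst (w <_) balanced (s≤s (m≤n+m w _)))
... | there w∈ = w∉ w∈
betaClosed⇒core (x ∷ ys) mono closed (Fin.suc i) =
  betaClosed⇒core ys (Linked.tail mono) (betaClosed-tail mono closed) i

core⇔betaClosed : ∀ {t λ′} → Linked _≥_ λ′ → IsCore t λ′ ⇔ BetaClosed t λ′
core⇔betaClosed mono = mk⇔ (core⇒betaClosed _ mono) (betaClosed⇒core _ mono)

gcd-positive : ∀ {s} r → 1 ≤ s → 1 ≤ gcd s r
gcd-positive {s} r 1≤s = n≢0⇒n>0 (gcd[m,n]≢0 s r (inj₁ (m<n⇒n≢0 1≤s)))

counted⇒betaClosed : ∀ {d r s λ′} → Counted d r s λ′ → BetaClosed s λ′ × BetaClosed (s + r) λ′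
counted⇒betaClosed ((_ , mono) , (core-s , core-s+r) , _) =
  Equivalence.to (core⇔betaClosed mono) core-s , Equivalence.to (core⇔betaClosed mono) core-s+r

counted-betas-bounded : ∀ {d r s} → 1 ≤ s → gcd s r ≤ d →
                        ∃ λ C → ∀ {λ′} → Counted d r s λ′ → ∀ {b} → b ∈ betas λ′ → b < C
counted-betas-bounded {r = r} {s} 1≤s g≤d with Bézout.identity (GCD.step (gcd-GCD s r))
... | Bézout.+- m₁ m₂ bézout = m₁ * s , λ counted@(_ , _ , distinct) →
  let closed-s , closed-s+r = counted⇒betaClosed counted
  in spaced-closed-bounded (betas-spaced distinct) closed-s closed-s+r (gcd-positive r 1≤s) g≤d m₁ m₂ bézout
... | Bézout.-+ m₂ m₁ bézout = m₁ * (s + r) , λ counted@(_ , _ , distinct) →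
  let closed-s , closed-s+r = counted⇒betaClosed counted
  in spaced-closed-bounded (betas-spaced distinct) closed-s+r closed-s (gcd-positive r 1≤s) g≤d m₁ m₂ bézout

boundedLists : ℕ → ℕ → List (List ℕ)
boundedLists c zero = [ [] ]
boundedLists c (suc n) = [] ∷ cartesianProductWith _∷_ (upTo c) (boundedLists c n)

∈-boundedLists : ∀ {c n xs} → length xs ≤ n → All (_< c) xs → xs ∈ boundedLists c n
∈-boundedLists {n = zero} {[]} _ _ = here refl
∈-boundedLists {n = suc n} {[]} _ _ = here refl
∈-boundedLists {n = suc n} {x ∷ xs} (s≤s len≤n) (x<c ∷ xs<c) =
  there (∈-cartesianProductWith⁺ _∷_ (∈-upTo⁺ x<c) (∈-boundedLists len≤n xs<c))

betas-bounded⇒∈-boundedLists : ∀ {C λ′} → Linked _≥_ λ′ → (∀ {b} → b ∈ betas λ′ → b < C) →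
                               λ′ ∈ boundedLists C C
betas-bounded⇒∈-boundedLists {λ′ = []} _ _ = ∈-boundedLists z≤n []
betas-bounded⇒∈-boundedLists {C} {x ∷ ys} mono bounded =
  ∈-boundedLists (≤-trans (s≤s (m≤n+m (length ys) x)) β₀<C)
                 (All.map (λ y≤x → ≤-<-trans y≤x x<C) (head≥all mono))
  where
  β₀<C : x + length ys < C
  β₀<C = bounded (here refl)
  x<C : x < C
  x<C = ≤-<-trans (m≤m+n x (length ys)) β₀<C

gcd≤⇒finite : ∀ {d r s} → 1 ≤ s → gcd s r ≤ d → NFinite d r s
gcd≤⇒finite 1≤s g≤d =
  let C , bounded = counted-betas-bounded 1≤s g≤d
  in boundedLists C C ,
     λ λ′ counted → betas-bounded⇒∈-boundedLists (proj₂ (proj₁ counted)) (bounded counted)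

progression-subtractionClosed : ∀ {n c} → c < n → ∀ k q →
                                SubtractionClosed (q * n) (applyDownFrom (λ i → i * n + c) k)
progression-subtractionClosed {n} {c} c<n k q {w} qn+w∈ with ∈-applyDownFrom⁻ (λ i → i * n + c) qn+w∈
... | i , i<k , qn+w≡ with q ≤? i
... | yes q≤i with o , refl ← m≤n⇒∃[o]m+o≡n q≤i =
  subst (_∈ _) (sym w≡) (∈-applyDownFrom⁺ (λ i → i * n + c) (≤-<-trans (m≤n+m o q) i<k))
  where
  regroup : ∀ q o n c → (q + o) * n + c ≡ q * n + (o * n + c)
  regroup = solve-∀
  w≡ : w ≡ o * n + c
  w≡ = +-cancelˡ-≡ (q * n) w (o * n + c) (trans qn+w≡ (regroup q o n c))
... | no q≰i = ⊥-elim (<⇒≱ in+c<qn (≤-trans (m≤m+n (q * n) w) (≤-reflexive qn+w≡)))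
  where
  in+c<qn : i * n + c < q * n
  in+c<qn = <-≤-trans (+-monoʳ-< (i * n) c<n)
                      (≤-trans (≤-reflexive (+-comm (i * n) n)) (*-monoˡ-≤ n (≰⇒> q≰i)))

staircase : ℕ → ℕ → List ℕ
staircase c zero = []
staircase c (suc k) = suc k * c ∷ staircase c k

length-staircase : ∀ c k → length (staircase c k) ≡ k
length-staircase c zero = refl
length-staircase c (suc k) = cong suc (length-staircase c k)

betas-staircase : ∀ c k → betas (staircase c k) ≡ applyDownFrom (λ i → i * suc c + c) k
betas-staircase c zero = refl
betas-staircase c (suc k) =
  cong₂ _∷_ (trans (cong (suc k * c +_) (length-staircase c k)) (regroup k c)) (betas-staircase c k)
  where
  regroup : ∀ k c → suc k * c + k ≡ k * suc c + c
  regroup = solve-∀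

staircase-distinct : ∀ {d c} → d ≤ c → ∀ k → DDistinct d (staircase c k)
staircase-distinct d≤c zero = []
staircase-distinct d≤c (suc zero) = [-]
staircase-distinct {c = c} d≤c (suc (suc k)) =
  ≤-trans (+-monoʳ-≤ (suc k * c) d≤c) (≤-reflexive (+-comm (suc k * c) c)) ∷ staircase-distinct d≤c (suc k)

staircase-positive : ∀ {c} → 1 ≤ c → ∀ k → All (1 ≤_) (staircase c k)
staircase-positive 1≤c zero = []
staircase-positive {c} 1≤c (suc k) = ≤-trans 1≤c (m≤m+n c (k * c)) ∷ staircase-positive 1≤c k

staircase-core : ∀ {c t} k → suc c ∣ t → IsCore t (staircase c k)
staircase-core {c} k (divides q refl) =
  betaClosed⇒core _ (distinct⇒nonincreasing (staircase-distinct ≤-refl k))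
    (subst (SubtractionClosed (q * suc c)) (sym (betas-staircase c k))
           (progression-subtractionClosed (n<1+n c) k q))

staircase-counted : ∀ {d r s c} → 1 ≤ d → d ≤ c → suc c ∣ s → suc c ∣ s + r →
                    ∀ k → Counted d r s (staircase c k)
staircase-counted 1≤d d≤c c+1∣s c+1∣s+r k =
  (staircase-positive (≤-trans 1≤d d≤c) k , distinct⇒nonincreasing (staircase-distinct d≤c k)) ,
  (staircase-core k c+1∣s , staircase-core k c+1∣s+r) ,
  staircase-distinct d≤c k

gcd>d⇒infinite : ∀ {d r s} → 1 ≤ d → d < gcd s r → ¬ NFinite d r s
gcd>d⇒infinite {d} {r} {s} 1≤d d<g (L , complete) with o , g≡ ← m≤n⇒∃[o]m+o≡n d<g =
  <⇒≱ (n<1+n n)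
      (subst (_≤ n) (length-staircase (d + o) (suc n)) (∈⇒≤sum (∈-map⁺ length (complete _ counted))))
  where
  n = sum (map length L)
  counted : Counted d r s (staircase (d + o) (suc n))
  counted = staircase-counted 1≤d (m≤m+n d o)
    (subst (_∣ s) (sym g≡) (gcd[m,n]∣m s r))
    (subst (_∣ s + r) (sym g≡) (∣m∣n⇒∣m+n (gcd[m,n]∣m s r) (gcd[m,n]∣n s r)))
    (suc n)

lemma2p4 : (d r s : ℕ) → 1 ≤ d → 1 ≤ r → 1 ≤ s → (NFinite d r s ⇔ gcd s r ≤ d)
lemma2p4 d r s 1≤d _ 1≤s = mk⇔ finite⇒gcd≤ (gcd≤⇒finite 1≤s)
  where
  finite⇒gcd≤ : NFinite d r s → gcd s r ≤ d
  finite⇒gcd≤ finite = decidable-stable (gcd s r ≤? d) (λ g≰d → gcd>d⇒infinite 1≤d (≰⇒> g≰d) finite)
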